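{- Let $\mathbf A$ be a connexive Heyting algebra. For all $a,b,c\in A$: $(a\rightarrow b)\rightarrow((b\rightarrow c)\rightarrow\neg(a\rightarrow\neg c))=1$.
   Context: A connexive Heyting algebra is an algebra $\langle A,\wedge,\vee,\rightarrow,0,1\rangle$ whose $\{\wedge,\vee,0,1\}$-reduct is a bounded distributive lattice with lattice order $\le$, satisfying, with $\neg x:=x\rightarrow0$: (C1) $(x\rightarrow y)\rightarrow((y\rightarrow z)\rightarrow(x\rightarrow z))=1$; (C2) $(x\rightarrow y)\rightarrow\neg(x\rightarrow\neg y)=1$; (C3) $x\wedge(x\rightarrow y)=x\wedge y$; (C4) $x\rightarrow y\le(z\wedge x)\rightarrow(z\wedge y)$; (C5) $x\rightarrow y\le(z\vee x)\rightarrow(z\vee y)$. -}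

module Defs where

open import Level using (Level; suc; _⊔_)
open import Relation.Binary.Core using (Rel)
open import Algebra.Core using (Op₂)
open import Algebra.Definitions using (Congruent₂)
open import Algebra.Lattice.Structures using (IsDistributiveLattice)

record ConnexiveHeytingAlgebra (c ℓ : Level) : Set (suc (c ⊔ ℓ)) where
  infixr 5 _⇒_
  infixr 7 _∧_
  infixr 6 _∨_
  infix 4 _≈_ _≤_
  field
    Carrier : Set c
    _≈_     : Rel Carrier ℓ
    _∧_     : Op₂ Carrier
    _∨_     : Op₂ Carrier
    _⇒_     : Op₂ Carrier
    𝟘       : Carrier
    𝟙       : Carrier
    isDistributiveLattice : IsDistributiveLattice _≈_ _∨_ _∧_
    ⇒-cong  : Congruent₂ _≈_ _⇒_
    𝟘-least    : ∀ x → 𝟘 ∧ x ≈ 𝟘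
    𝟙-greatest : ∀ x → x ∧ 𝟙 ≈ x

  _≤_ : Rel Carrier ℓ
  x ≤ y = x ∧ y ≈ x

  ¬_ : Carrier → Carrier
  ¬ x = x ⇒ 𝟘

  field
    C1 : ∀ x y z → (x ⇒ y) ⇒ ((y ⇒ z) ⇒ (x ⇒ z)) ≈ 𝟙
    C2 : ∀ x y → (x ⇒ y) ⇒ (¬ (x ⇒ ¬ y)) ≈ 𝟙
    C3 : ∀ x y → x ∧ (x ⇒ y) ≈ x ∧ y
    C4 : ∀ x y z → (x ⇒ y) ≤ ((z ∧ x) ⇒ (z ∧ y))
    C5 : ∀ x y z → (x ⇒ y) ≤ ((z ∨ x) ⇒ (z ∨ y))

  open IsDistributiveLattice isDistributiveLattice public

{-# OPTIONS --safe #-}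
-- (C3) at x = 𝟙 gives 𝟙 ⇒ x ≈ x, so by (C1) valid implications (x ⇒ y ≈ 𝟙)
-- obey modus ponens, transitivity and right monotonicity. The claim composes
-- the (C1)-instance (a ⇒ b) ⇒ ((b ⇒ c′) ⇒ (a ⇒ c′)) with (C2) for a, c′,
-- lifted under (b ⇒ c′) ⇒ _.
module Submission where

open import Level using (Level)
open import Relation.Binary.Bundles using (Setoid)
import Relation.Binary.Reasoning.Setoid as ≈-Reasoning
open import Defs

module ConnexiveHeytingAlgebraProperties
  {c ℓ : Level} (A : ConnexiveHeytingAlgebra c ℓ) where

  open ConnexiveHeytingAlgebra A

  carrierSetoid : Setoid c ℓ
  carrierSetoid = record { isEquivalence = isEquivalence }

  open ≈-Reasoning carrierSetoid

  ⇒-identityˡ : ∀ x → 𝟙 ⇒ x ≈ x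
  ⇒-identityˡ x = begin
    𝟙 ⇒ x            ≈⟨ 𝟙-greatest (𝟙 ⇒ x) ⟨
    (𝟙 ⇒ x) ∧ 𝟙      ≈⟨ ∧-comm (𝟙 ⇒ x) 𝟙 ⟩
    𝟙 ∧ (𝟙 ⇒ x)      ≈⟨ C3 𝟙 x ⟩
    𝟙 ∧ x            ≈⟨ ∧-comm 𝟙 x ⟩
    x ∧ 𝟙            ≈⟨ 𝟙-greatest x ⟩
    x                ∎

  modusPonens : ∀ {x y} → x ⇒ y ≈ 𝟙 → x ≈ 𝟙 → y ≈ 𝟙
  modusPonens {x} {y} x⇒y≈𝟙 x≈𝟙 = begin
    y       ≈⟨ ⇒-identityˡ y ⟨
    𝟙 ⇒ y   ≈⟨ ⇒-cong x≈𝟙 refl ⟨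
    x ⇒ y   ≈⟨ x⇒y≈𝟙 ⟩
    𝟙       ∎

  ⇒-valid-trans : ∀ {x y z} → x ⇒ y ≈ 𝟙 → y ⇒ z ≈ 𝟙 → x ⇒ z ≈ 𝟙
  ⇒-valid-trans {x} {y} {z} x⇒y≈𝟙 y⇒z≈𝟙 =
    modusPonens (modusPonens (C1 x y z) x⇒y≈𝟙) y⇒z≈𝟙

  ⇒-valid-monoʳ : ∀ {y z} x → y ⇒ z ≈ 𝟙 → (x ⇒ y) ⇒ (x ⇒ z) ≈ 𝟙
  ⇒-valid-monoʳ {y} {z} x y⇒z≈𝟙 = begin
    (x ⇒ y) ⇒ (x ⇒ z)                  ≈⟨ ⇒-cong refl (⇒-identityˡ (x ⇒ z)) ⟨
    (x ⇒ y) ⇒ (𝟙 ⇒ (x ⇒ z))            ≈⟨ ⇒-cong refl (⇒-cong y⇒z≈𝟙 refl) ⟨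
    (x ⇒ y) ⇒ ((y ⇒ z) ⇒ (x ⇒ z))      ≈⟨ C1 x y z ⟩
    𝟙                                  ∎

lemma3p8 : ∀ {c ℓ : Level} (A : ConnexiveHeytingAlgebra c ℓ) →
    let open ConnexiveHeytingAlgebra A in
    ∀ a b c′ → (a ⇒ b) ⇒ ((b ⇒ c′) ⇒ (¬ (a ⇒ ¬ c′))) ≈ 𝟙
lemma3p8 A a b c′ =
  ⇒-valid-trans (C1 a b c′) (⇒-valid-monoʳ (b ⇒ c′) (C2 a c′))
  where
  open ConnexiveHeytingAlgebra A
  open ConnexiveHeytingAlgebraProperties A
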